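{- Let $n$ be prime and $d=\lfloor n/2\rfloor$. The polytope $EL(n)$ has exactly $d$ vertices and exactly $d$ facets. Specifically, $EL(n)$ is the scaled simplex $\{x\in\mathbb{R}^d: x_1+\dots+x_d=n,\ x_i\ge 0 \text{ for } i=1,\dots,d\}$.
   Context: For an integer $n\ge 3$, let $K_n$ be the complete graph on vertex set $[n]=\{1,\dots,n\}$ with edge set $E_n$, and let $d=\lfloor n/2\rfloor$. The length of an edge $\{i,j\}$ is $\ell_{i,j}=\min\{|i-j|,\,n-|i-j|\}\in\{1,\dots,d\}$. For a Hamiltonian cycle $H$ on $K_n$, let $\chi_H\in\mathbb{R}^{E_n}$ be its edge-incidence vector. The symmetric TSP polytope is $STSP(n)=\mathrm{conv}\{\chi_H: H \text{ a Hamiltonian cycle of } K_n\}$. The edge-length polytope $EL(n)\subset\mathbb{R}^d$ is the image of $STSP(n)$ under the linear map $x\mapsto (t_1,\dots,t_d)$ with $t_i=\sum_{\{s,t\}\in E_n:\ \ell_{s,t}=i} x_{s,t}$; equivalently, $EL(n)$ is the convex hull of the edge-length vectors of Hamiltonian cycles of $K_n$.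
   Formalization: EL(n) and the scaled simplex are compared only at points with rational coordinates, using convex combinations with rational coefficients, rather than on all of ℝ^d. -}

module Defs where

open import Data.Nat as ℕ using (ℕ; suc; _⊓_; _∸_; ∣_-_∣)
open import Data.Nat.DivMod using (_/_)
open import Data.Fin using (Fin; toℕ)
open import Data.List using (List; []; _∷_; _++_; [_]; zip; filter; length; map; foldr)
open import Data.List.Relation.Unary.Unique.Propositional using (Unique)
open import Data.Integer using (+_)
open import Data.Rational using (ℚ; 0ℚ; 1ℚ; _+_; _*_; _≤_)
import Data.Rational as Q
open import Data.Product using (Σ; _×_; _,_; proj₁; proj₂)
open import Data.List.Relation.Unary.All using (All)
open import Relation.Binary.PropositionalEquality using (_≡_)

ℕ→ℚ : ℕ → ℚ
ℕ→ℚ k = (+ k) Q./ 1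

half : ℕ → ℕ
half n = n / 2

-- length of edge {i,j} in K_n (vertices 0..n-1; same differences as 1..n)
edgeLen : (n : ℕ) → Fin n → Fin n → ℕ
edgeLen n i j = ∣ toℕ i - toℕ j ∣ ⊓ (n ∸ ∣ toℕ i - toℕ j ∣)

-- A Hamiltonian cycle of K_n, given by listing its vertices in cyclic order:
-- a duplicate-free list containing all n vertices.
record HamCycle (n : ℕ) : Set where
  constructor hamCycle
  field
    verts  : List (Fin n)
    unique : Unique verts
    full   : length verts ≡ n
open HamCycle public

cycleEdges : {A : Set} → List A → List (A × A)
cycleEdges []       = []
cycleEdges (v ∷ vs) = zip (v ∷ vs) (vs ++ [ v ])

countLen : (n : ℕ) → HamCycle n → ℕ → ℕ
countLen n H ℓ =
  length (filter (λ e → edgeLen n (proj₁ e) (proj₂ e) ℕ.≟ ℓ) (cycleEdges (verts H)))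

-- edge-length vector (t_1,…,t_d) of H; coordinate i : Fin d stands for length i+1
lengthVec : (n : ℕ) → HamCycle n → Fin (half n) → ℚ
lengthVec n H i = ℕ→ℚ (countLen n H (suc (toℕ i)))

sumℚ : List ℚ → ℚ
sumℚ = foldr _+_ 0ℚ

sumFin : (d : ℕ) → (Fin d → ℚ) → ℚ
sumFin d x = sumℚ (map x (Data.List.allFin d))
  where import Data.List

-- EL(n) (rational points): x is a convex combination of edge-length vectors
-- of finitely many Hamiltonian cycles of K_n.
InEL : (n : ℕ) → (Fin (half n) → ℚ) → Set
InEL n x =
  Σ (List (ℚ × HamCycle n)) λ cs →
    All (λ c → 0ℚ ≤ proj₁ c) cs ×
    sumℚ (map proj₁ cs) ≡ 1ℚ ×
    ((i : Fin (half n)) → x i ≡ sumℚ (map (λ c → proj₁ c * lengthVec n (proj₂ c) i) cs))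

InSimplex : (n : ℕ) → (Fin (half n) → ℚ) → Set
InSimplex n x = sumFin (half n) x ≡ ℕ→ℚ n × ((i : Fin (half n)) → 0ℚ ≤ x i)

module Submission where

-- Every Hamiltonian cycle of K_n has n edges, each of length between 1 and d, so
-- its edge-length vector lies on the simplex x_1 + … + x_d = n, x ≥ 0, and so does
-- every convex combination of such vectors. Conversely, when n is prime every
-- k ∈ {1, …, d} is invertible mod n, so 0, k, 2k, …, (n − 1)k (mod n) is a
-- Hamiltonian cycle all of whose n edges have length k. Its edge-length vector is
-- the vertex n·e_k of the simplex, and x = Σ_k (x_k / n)·(n·e_k).

open import Defs
open import Data.Nat using (ℕ; _≤_; suc)
open import Data.Nat.Primality using (Prime)
open import Data.Fin using (Fin)
open import Data.Rational using (ℚ)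
open import Data.Product using (_×_)

open import Algebra.Bundles using (CommutativeSemiring; CommutativeRing)
open import Data.Fin using (zero; suc; toℕ; fromℕ<)
import Data.Fin.Properties as Fin
open import Data.List using (List; []; _∷_; _++_; [_]; _∷ʳ_; map; foldr; zip; applyUpTo; length; filter; allFin)
open import Data.List.Properties using (map-tabulate)
open import Function using (_∘_; id)
open import Relation.Binary.PropositionalEquality hiding ([_]; setoid)

module ListSum {c ℓ} (R : CommutativeSemiring c ℓ) where
  open CommutativeSemiring R using (Carrier; _≈_; _+_; _*_; 0#; setoid)
  private module R = CommutativeSemiring R
  open import Relation.Binary.Reasoning.Setoid setoid
  open import Algebra.Properties.CommutativeSemigroup R.+-commutativeSemigroup using (interchange)

  sum : List Carrier → Carrier
  sum = foldr _+_ 0#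

  module _ {a} {A : Set a} where

    sum-cong : ∀ {f g : A → Carrier} xs → (∀ x → f x ≈ g x) → sum (map f xs) ≈ sum (map g xs)
    sum-cong []       f≈g = R.refl
    sum-cong (x ∷ xs) f≈g = R.+-cong (f≈g x) (sum-cong xs f≈g)

    sum-zero : ∀ {f : A → Carrier} xs → (∀ x → f x ≈ 0#) → sum (map f xs) ≈ 0#
    sum-zero []       f≈0 = R.refl
    sum-zero (x ∷ xs) f≈0 = R.trans (R.+-cong (f≈0 x) (sum-zero xs f≈0)) (R.+-identityˡ 0#)

    sum-distrib-+ : ∀ (f g : A → Carrier) xs →
      sum (map (λ x → f x + g x) xs) ≈ sum (map f xs) + sum (map g xs)
    sum-distrib-+ f g []       = R.sym (R.+-identityˡ 0#)
    sum-distrib-+ f g (x ∷ xs) = R.trans (R.+-congˡ (sum-distrib-+ f g xs)) (interchange (f x) (g x) _ _)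

    sum-distribˡ-* : ∀ (f : A → Carrier) c xs → sum (map (λ x → c * f x) xs) ≈ c * sum (map f xs)
    sum-distribˡ-* f c []       = R.sym (R.zeroʳ c)
    sum-distribˡ-* f c (x ∷ xs) = R.trans (R.+-congˡ (sum-distribˡ-* f c xs)) (R.sym (R.distribˡ c (f x) _))

    sum-distribʳ-* : ∀ (f : A → Carrier) c xs → sum (map (λ x → f x * c) xs) ≈ sum (map f xs) * c
    sum-distribʳ-* f c []       = R.sym (R.zeroˡ c)
    sum-distribʳ-* f c (x ∷ xs) = R.trans (R.+-congˡ (sum-distribʳ-* f c xs)) (R.sym (R.distribʳ c (f x) _))

  sum-comm : ∀ {a b} {A : Set a} {B : Set b} (g : A → B → Carrier) xs ys →
    sum (map (λ x → sum (map (g x) ys)) xs) ≈ sum (map (λ y → sum (map (λ x → g x y) xs)) ys)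
  sum-comm g []       ys = R.sym (sum-zero ys (λ _ → R.refl))
  sum-comm g (x ∷ xs) ys = begin
    sum (map (g x) ys) + sum (map (λ x → sum (map (g x) ys)) xs)
      ≈⟨ R.+-congˡ (sum-comm g xs ys) ⟩
    sum (map (g x) ys) + sum (map (λ y → sum (map (λ x → g x y) xs)) ys)
      ≈⟨ sum-distrib-+ (g x) (λ y → sum (map (λ x → g x y) xs)) ys ⟨
    sum (map (λ y → g x y + sum (map (λ x → g x y) xs)) ys) ∎

  sum-allFin-suc : ∀ {d} (f : Fin (suc d) → Carrier) →
    sum (map f (allFin (suc d))) ≈ f zero + sum (map (f ∘ suc) (allFin d))
  sum-allFin-suc {d} f = R.reflexive (cong (λ xs → f zero + sum xs)
    (trans (map-tabulate suc f) (sym (map-tabulate id (f ∘ suc)))))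

  sum-allFin-single : ∀ {d} (f : Fin d → Carrier) i → (∀ j → j ≢ i → f j ≈ 0#) →
    sum (map f (allFin d)) ≈ f i
  sum-allFin-single f zero f≈0 = begin
    sum (map f (allFin _))                  ≈⟨ sum-allFin-suc f ⟩
    f zero + sum (map (f ∘ suc) (allFin _)) ≈⟨ R.+-congˡ (sum-zero (allFin _) (λ j → f≈0 (suc j) λ ())) ⟩
    f zero + 0#                             ≈⟨ R.+-identityʳ (f zero) ⟩
    f zero                                  ∎
  sum-allFin-single f (suc i) f≈0 = begin
    sum (map f (allFin _))                  ≈⟨ sum-allFin-suc f ⟩
    f zero + sum (map (f ∘ suc) (allFin _)) ≈⟨ R.+-cong (f≈0 zero λ ()) (sum-allFin-single (f ∘ suc) i
                                                 (λ j j≢i → f≈0 (suc j) (j≢i ∘ Fin.suc-injective))) ⟩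
    0# + f (suc i)                          ≈⟨ R.+-identityˡ (f (suc i)) ⟩
    f (suc i)                               ∎

-- Opened only here: ℕ's operators and laws would clash with the field names used in ListSum.
open import Data.Nat
open import Data.Nat.Properties
open import Algebra.Properties.CommutativeSemigroup +-commutativeSemigroup using (xy∙z≈xz∙y)
open import Data.Bool using (true; false; if_then_else_)
open import Data.Fin.Properties using (toℕ-fromℕ<; toℕ-injective; toℕ<n; fromℕ<-cong)
import Data.Integer as ℤ
import Data.Integer.Properties as ℤ
open import Data.List.Properties
  using (applyUpTo-∷ʳ; length-zipWith; length-++; length-applyUpTo; map-∘; filter-all; filter-none)
open import Data.List.Relation.Unary.All as All using (All; []; _∷_)
open import Data.List.Relation.Unary.All.Properties as All using (applyUpTo⁺₂)
open import Data.List.Relation.Unary.AllPairs using (_∷_)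
open import Data.List.Relation.Unary.Unique.Propositional using (Unique)
open import Data.List.Relation.Unary.Unique.Propositional.Properties using (applyUpTo⁺₁)
open import Data.Nat.Coprimality as Coprime using ()
open import Data.Nat.DivMod
open import Data.Nat.Divisibility
open import Data.Nat.Primality using (euclidsLemma; prime⇒nonZero)
open import Data.Product using (_,_; proj₁; proj₂; uncurry)
open import Data.Rational as ℚ using (0ℚ; 1ℚ)
import Data.Rational.Properties as ℚ
import Data.Rational.Unnormalised as ℚᵘ
import Data.Rational.Unnormalised.Properties as ℚᵘ
open import Data.Sum using ([_,_]′)
open import Relation.Nullary using (does; yes; no)
open import Relation.Nullary.Decidable using (dec-true; dec-false)
open import Relation.Unary using (Pred; Decidable)

m≤n/2⇒m+m≤n : ∀ {m} n → m ≤ n / 2 → m + m ≤ n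
m≤n/2⇒m+m≤n {m} n m≤n/2 = begin
  m + m       ≡⟨ cong (m +_) (+-identityʳ m) ⟨
  2 * m       ≡⟨ *-comm 2 m ⟩
  m * 2       ≤⟨ *-monoˡ-≤ 2 m≤n/2 ⟩
  n / 2 * 2   ≤⟨ m/n*n≤m n 2 ⟩
  n           ∎
  where open ≤-Reasoning

m+m≤n⇒m≤n/2 : ∀ {m} n → m + m ≤ n → m ≤ n / 2
m+m≤n⇒m≤n/2 {m} n m+m≤n = begin
  m             ≡⟨ m*n/n≡m m 2 ⟨
  m * 2 / 2     ≡⟨ cong (_/ 2) (*-comm m 2) ⟩
  2 * m / 2     ≡⟨ cong (λ k → (m + k) / 2) (+-identityʳ m) ⟩
  (m + m) / 2   ≤⟨ /-monoˡ-≤ 2 m+m≤n ⟩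
  n / 2         ∎
  where open ≤-Reasoning

m+m≤n⇒m⊓[n∸m]≡m : ∀ {m n} → m + m ≤ n → m ⊓ (n ∸ m) ≡ m
m+m≤n⇒m⊓[n∸m]≡m {m} m+m≤n = m≤n⇒m⊓n≡m (m+n≤o⇒m≤o∸n m m+m≤n)

m≤n⇒m⊓[n∸m]≤n/2 : ∀ {m n} → m ≤ n → m ⊓ (n ∸ m) ≤ n / 2
m≤n⇒m⊓[n∸m]≤n/2 {m} {n} m≤n = m+m≤n⇒m≤n/2 n (begin
  m ⊓ (n ∸ m) + m ⊓ (n ∸ m) ≤⟨ +-mono-≤ (m⊓n≤m m (n ∸ m)) (m⊓n≤n m (n ∸ m)) ⟩
  m + (n ∸ m)               ≡⟨ m+[n∸m]≡n m≤n ⟩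
  n                         ∎)
  where open ≤-Reasoning

-- edgeLen n i j unfolds to cyclicDist n (toℕ i) (toℕ j).
cyclicDist : ℕ → ℕ → ℕ → ℕ
cyclicDist n a b = ∣ a - b ∣ ⊓ (n ∸ ∣ a - b ∣)

cyclicDist-+ : ∀ {n a k} .{{_ : NonZero n}} → a < n → k + k ≤ n → cyclicDist n a ((a + k) % n) ≡ k
cyclicDist-+ {n} {a} {k} a<n k+k≤n with a + k <? n
... | yes a+k<n = begin
  cyclicDist n a ((a + k) % n) ≡⟨ cong (cyclicDist n a) (m<n⇒m%n≡m a+k<n) ⟩
  cyclicDist n a (a + k)       ≡⟨ cong (λ d → d ⊓ (n ∸ d)) (∣m-m+n∣≡n a k) ⟩
  k ⊓ (n ∸ k)                  ≡⟨ m+m≤n⇒m⊓[n∸m]≡m k+k≤n ⟩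
  k                            ∎
  where open ≡-Reasoning
... | no a+k≮n = begin
  cyclicDist n a ((a + k) % n) ≡⟨ cong (cyclicDist n a) wrap ⟩
  cyclicDist n a (a ∸ (n ∸ k)) ≡⟨ cong (λ d → d ⊓ (n ∸ d)) ∣a-[a∸[n∸k]]∣≡n∸k ⟩
  (n ∸ k) ⊓ (n ∸ (n ∸ k))      ≡⟨ cong ((n ∸ k) ⊓_) (m∸[m∸n]≡n k≤n) ⟩
  (n ∸ k) ⊓ k                  ≡⟨ ⊓-comm (n ∸ k) k ⟩
  k ⊓ (n ∸ k)                  ≡⟨ m+m≤n⇒m⊓[n∸m]≡m k+k≤n ⟩
  k                            ∎
  where
  open ≡-Reasoning
  k≤n : k ≤ n
  k≤n = m+n≤o⇒m≤o k k+k≤n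
  n∸k≤a : n ∸ k ≤ a
  n∸k≤a = m≤n+o⇒m∸n≤o n k (subst (n ≤_) (+-comm a k) (≮⇒≥ a+k≮n))
  ∣a-[a∸[n∸k]]∣≡n∸k : ∣ a - (a ∸ (n ∸ k)) ∣ ≡ n ∸ k
  ∣a-[a∸[n∸k]]∣≡n∸k = trans (m≤n⇒∣n-m∣≡n∸m (m∸n≤m a (n ∸ k))) (m∸[m∸n]≡n n∸k≤a)
  wrap : (a + k) % n ≡ a ∸ (n ∸ k)
  wrap = begin
    (a + k) % n                         ≡⟨ cong (λ b → (b + k) % n) (m∸n+n≡m n∸k≤a) ⟨
    (a ∸ (n ∸ k) + (n ∸ k) + k) % n     ≡⟨ cong (_% n) (+-assoc (a ∸ (n ∸ k)) (n ∸ k) k) ⟩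
    (a ∸ (n ∸ k) + ((n ∸ k) + k)) % n   ≡⟨ cong (λ b → (a ∸ (n ∸ k) + b) % n) (m∸n+n≡m k≤n) ⟩
    (a ∸ (n ∸ k) + n) % n               ≡⟨ [m+n]%n≡m%n (a ∸ (n ∸ k)) n ⟩
    (a ∸ (n ∸ k)) % n                   ≡⟨ m<n⇒m%n≡m (≤-<-trans (m∸n≤m a (n ∸ k)) a<n) ⟩
    a ∸ (n ∸ k)                         ∎

cyclicDist-%-+ : ∀ {n} a {k} .{{_ : NonZero n}} → k + k ≤ n → cyclicDist n (a % n) ((a + k) % n) ≡ k
cyclicDist-%-+ {n} a {k} k+k≤n = begin
  cyclicDist n (a % n) ((a + k) % n)       ≡⟨ cong (λ b → cyclicDist n (a % n) ((b + k) % n)) (m≡m%n+[m/n]*n a n) ⟩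
  cyclicDist n (a % n) ((a % n + a / n * n + k) % n) ≡⟨ cong (λ b → cyclicDist n (a % n) (b % n)) (xy∙z≈xz∙y (a % n) (a / n * n) k) ⟩
  cyclicDist n (a % n) ((a % n + k + a / n * n) % n) ≡⟨ cong (cyclicDist n (a % n)) ([m+kn]%n≡m%n (a % n + k) (a / n) n) ⟩
  cyclicDist n (a % n) ((a % n + k) % n)   ≡⟨ cyclicDist-+ (m%n<n a n) k+k≤n ⟩
  k                                        ∎
  where open ≡-Reasoning

cyclicDist-positive : ∀ {n a b} → a ≢ b → a < n → b < n → 0 < cyclicDist n a b
cyclicDist-positive {n} {a} {b} a≢b a<n b<n = ⊓-glb (n≢0⇒n>0 (a≢b ∘ ∣m-n∣≡0⇒m≡n)) (m<n⇒0<n∸m ∣a-b∣<n)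
  where
  ∣a-b∣<n : ∣ a - b ∣ < n
  ∣a-b∣<n = ≤-<-trans (∣m-n∣≤m⊔n a b) (⊔-lub a<n b<n)

cyclicDist≤n/2 : ∀ {n a b} → a ≤ n → b ≤ n → cyclicDist n a b ≤ n / 2
cyclicDist≤n/2 {n} {a} {b} a≤n b≤n = m≤n⇒m⊓[n∸m]≤n/2 (≤-trans (∣m-n∣≤m⊔n a b) (⊔-lub a≤n b≤n))

[m+o]%n≡m%n⇒n∣o : ∀ m o {n} .{{_ : NonZero n}} → (m + o) % n ≡ m % n → n ∣ o
[m+o]%n≡m%n⇒n∣o m o {n} eq = ∣m+n∣m⇒∣n (divides ((m + o) / n) qn+o≡q′n) (n∣m*n (m / n))
  where
  open ≡-Reasoning
  qn+o≡q′n : m / n * n + o ≡ (m + o) / n * n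
  qn+o≡q′n = +-cancelˡ-≡ (m % n) _ _ (begin
    m % n + (m / n * n + o)       ≡⟨ +-assoc (m % n) (m / n * n) o ⟨
    m % n + m / n * n + o         ≡⟨ cong (_+ o) (m≡m%n+[m/n]*n m n) ⟨
    m + o                         ≡⟨ m≡m%n+[m/n]*n (m + o) n ⟩
    (m + o) % n + (m + o) / n * n ≡⟨ cong (_+ (m + o) / n * n) eq ⟩
    m % n + (m + o) / n * n       ∎)

*-%-injective-prime : ∀ {p k i j} .{{_ : NonZero p}} → Prime p → p ∤ k → i < j → j < p →
  (i * k) % p ≢ (j * k) % p
*-%-injective-prime {p} {k} {i} {j} prime-p p∤k i<j j<p [ik]≡[jk] =
  [ p∤j∸i , p∤k ]′ (euclidsLemma (j ∸ i) k prime-p p∣[j∸i]k)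
  where
  p∤j∸i : p ∤ j ∸ i
  p∤j∸i = >⇒∤ {{>-nonZero (m<n⇒0<n∸m i<j)}} (≤-<-trans (m∸n≤m j i) j<p)
  jk≡ik+[j∸i]k : j * k ≡ i * k + (j ∸ i) * k
  jk≡ik+[j∸i]k = trans (cong (_* k) (sym (m+[n∸m]≡n (<⇒≤ i<j)))) (*-distribʳ-+ k i (j ∸ i))
  p∣[j∸i]k : p ∣ (j ∸ i) * k
  p∣[j∸i]k = [m+o]%n≡m%n⇒n∣o (i * k) ((j ∸ i) * k) (trans (cong (_% p) (sym jk≡ik+[j∸i]k)) (sym [ik]≡[jk]))

module _ {A : Set} where

  zip-applyUpTo : ∀ {B : Set} (f : ℕ → A) (g : ℕ → B) m →
    zip (applyUpTo f m) (applyUpTo g m) ≡ applyUpTo (λ t → f t , g t) m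
  zip-applyUpTo f g zero    = refl
  zip-applyUpTo f g (suc m) = cong (_ ∷_) (zip-applyUpTo (f ∘ suc) (g ∘ suc) m)

  cycleEdges-applyUpTo : ∀ (f : ℕ → A) m → f m ≡ f 0 →
    cycleEdges (applyUpTo f m) ≡ applyUpTo (λ t → f t , f (suc t)) m
  cycleEdges-applyUpTo f zero    _        = refl
  cycleEdges-applyUpTo f (suc m) periodic = begin
    zip (applyUpTo f (suc m)) (applyUpTo (f ∘ suc) m ∷ʳ f 0)     ≡⟨ cong (λ v → zip (applyUpTo f (suc m)) (applyUpTo (f ∘ suc) m ∷ʳ v)) periodic ⟨
    zip (applyUpTo f (suc m)) (applyUpTo (f ∘ suc) m ∷ʳ f (suc m)) ≡⟨ cong (zip _) (applyUpTo-∷ʳ (f ∘ suc) m) ⟩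
    zip (applyUpTo f (suc m)) (applyUpTo (f ∘ suc) (suc m))       ≡⟨ zip-applyUpTo f (f ∘ suc) (suc m) ⟩
    applyUpTo (λ t → f t , f (suc t)) (suc m)                      ∎
    where open ≡-Reasoning

  length-cycleEdges : ∀ (vs : List A) → length (cycleEdges vs) ≡ length vs
  length-cycleEdges []       = refl
  length-cycleEdges (v ∷ vs) = begin
    length (zip (v ∷ vs) (vs ++ [ v ]))    ≡⟨ length-zipWith _,_ (v ∷ vs) (vs ++ [ v ]) ⟩
    suc (length vs) ⊓ length (vs ++ [ v ]) ≡⟨ cong (suc (length vs) ⊓_) (trans (length-++ vs) (+-comm (length vs) 1)) ⟩
    suc (length vs) ⊓ suc (length vs)      ≡⟨ ⊓-idem _ ⟩
    suc (length vs)                        ∎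
    where open ≡-Reasoning

  cycleEdges-irreflexive : ∀ {vs : List A} → Unique vs → 2 ≤ length vs →
    All (uncurry _≢_) (cycleEdges vs)
  cycleEdges-irreflexive {_ ∷ []} _ (s≤s ())
  cycleEdges-irreflexive {v ∷ w ∷ ws} unique@(v∉ ∷ _) _ = go unique (All.map (λ v≢y y≡v → v≢y (sym y≡v)) v∉)
    where
    go : ∀ {x y ys} → Unique (x ∷ y ∷ ys) → All (_≢ v) (y ∷ ys) →
      All (uncurry _≢_) (zip (x ∷ y ∷ ys) (y ∷ ys ++ [ v ]))
    go {ys = []}     ((x≢y ∷ _) ∷ _) (y≢v ∷ [])  = x≢y ∷ y≢v ∷ []
    go {ys = _ ∷ _}  ((x≢y ∷ _) ∷ u) (_ ∷ ys≢v)  = x≢y ∷ go u ys≢v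

  length-filter-∷ : ∀ {p} {P : Pred A p} (P? : Decidable P) x xs →
    length (filter P? (x ∷ xs)) ≡ (if does (P? x) then 1 else 0) + length (filter P? xs)
  length-filter-∷ P? x xs with does (P? x)
  ... | true  = refl
  ... | false = refl

module ℕΣ = ListSum +-*-commutativeSemiring
module ℚΣ = ListSum (CommutativeRing.commutativeSemiring ℚ.+-*-commutativeRing)

sum-if-≟ : ∀ {d m} → 1 ≤ m → m ≤ d →
  ℕΣ.sum (map (λ (i : Fin d) → if does (m ≟ suc (toℕ i)) then 1 else 0) (allFin d)) ≡ 1
sum-if-≟ {d} {suc m} _ m<d = trans (ℕΣ.sum-allFin-single _ i₀ miss) hit
  where
  i₀ : Fin d
  i₀ = fromℕ< m<d
  hit : (if does (suc m ≟ suc (toℕ i₀)) then 1 else 0) ≡ 1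
  hit rewrite dec-true (suc m ≟ suc (toℕ i₀)) (cong suc (sym (toℕ-fromℕ< m<d))) = refl
  miss : ∀ j → j ≢ i₀ → (if does (suc m ≟ suc (toℕ j)) then 1 else 0) ≡ 0
  miss j j≢i₀ rewrite dec-false (suc m ≟ suc (toℕ j)) λ m≡j →
    j≢i₀ (toℕ-injective (trans (suc-injective (sym m≡j)) (sym (toℕ-fromℕ< m<d)))) = refl

module _ {A : Set} where

  sum-length-filter-≟ : ∀ d (f : A → ℕ) xs → All (λ x → 1 ≤ f x × f x ≤ d) xs →
    ℕΣ.sum (map (λ (i : Fin d) → length (filter (λ x → f x ≟ suc (toℕ i)) xs)) (allFin d)) ≡ length xs
  sum-length-filter-≟ d f []       []                          = ℕΣ.sum-zero (allFin d) (λ _ → refl)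
  sum-length-filter-≟ d f (x ∷ xs) ((1≤fx , fx≤d) ∷ xs-bounds) = begin
    ℕΣ.sum (map (λ i → count i (x ∷ xs)) (allFin d))                   ≡⟨ ℕΣ.sum-cong (allFin d) (λ i → length-filter-∷ (value≟ i) x xs) ⟩
    ℕΣ.sum (map (λ i → hit i + count i xs) (allFin d))                 ≡⟨ ℕΣ.sum-distrib-+ hit (λ i → count i xs) (allFin d) ⟩
    ℕΣ.sum (map hit (allFin d)) + ℕΣ.sum (map (λ i → count i xs) (allFin d)) ≡⟨ cong₂ _+_ (sum-if-≟ 1≤fx fx≤d) (sum-length-filter-≟ d f xs xs-bounds) ⟩
    1 + length xs                                                     ∎
    where
    open ≡-Reasoning
    value≟ : (i : Fin d) → Decidable (λ y → f y ≡ suc (toℕ i))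
    value≟ i y = f y ≟ suc (toℕ i)
    count : Fin d → List A → ℕ
    count i ys = length (filter (value≟ i) ys)
    hit : Fin d → ℕ
    hit i = if does (value≟ i x) then 1 else 0

length-cycleEdges-verts : ∀ {n} (H : HamCycle n) → length (cycleEdges (verts H)) ≡ n
length-cycleEdges-verts H = trans (length-cycleEdges (verts H)) (full H)

edgeLen-bounds : ∀ {n} {i j : Fin n} → i ≢ j → 1 ≤ edgeLen n i j × edgeLen n i j ≤ half n
edgeLen-bounds {n} {i} {j} i≢j =
  cyclicDist-positive (i≢j ∘ toℕ-injective) (toℕ<n i) (toℕ<n j) ,
  cyclicDist≤n/2 (<⇒≤ (toℕ<n i)) (<⇒≤ (toℕ<n j))

sum-countLen : ∀ {n} → 2 ≤ n → (H : HamCycle n) →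
  ℕΣ.sum (map (λ i → countLen n H (suc (toℕ i))) (allFin (half n))) ≡ n
sum-countLen {n} 2≤n H = trans
  (sum-length-filter-≟ (half n) (uncurry (edgeLen n)) (cycleEdges (verts H)) (All.map edgeLen-bounds edges-irreflexive))
  (length-cycleEdges-verts H)
  where
  edges-irreflexive : All (uncurry _≢_) (cycleEdges (verts H))
  edges-irreflexive = cycleEdges-irreflexive (unique H) (subst (2 ≤_) (sym (full H)) 2≤n)

module _ {n} (H : HamCycle n) {k} (uniform : All (λ e → uncurry (edgeLen n) e ≡ k) (cycleEdges (verts H))) where

  countLen-uniform : countLen n H k ≡ n
  countLen-uniform = trans (cong length (filter-all (λ e → uncurry (edgeLen n) e ≟ k) uniform)) (length-cycleEdges-verts H)

  countLen-uniform-≢ : ∀ {ℓ} → ℓ ≢ k → countLen n H ℓ ≡ 0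
  countLen-uniform-≢ {ℓ} ℓ≢k = cong length (filter-none (λ e → uncurry (edgeLen n) e ≟ ℓ)
    (All.map (λ e≡k e≡ℓ → ℓ≢k (trans (sym e≡ℓ) e≡k)) uniform))

ℕ→ℚ-+ : ∀ m o → ℕ→ℚ (m + o) ≡ ℕ→ℚ m ℚ.+ ℕ→ℚ o
ℕ→ℚ-+ m o = ℚ.toℚᵘ-injective (ℚᵘ.≃-trans toℚᵘ-+ (ℚᵘ.≃-sym (ℚ.toℚᵘ-homo-+ (ℕ→ℚ m) (ℕ→ℚ o))))
  where
  -- ℕ→ℚ normalises its argument, which only computes on closed numerals.
  ℕ→ℚ≡mkℚ : ∀ k → ℕ→ℚ k ≡ ℚ.mkℚ (ℤ.+ k) 0 (Coprime.sym (Coprime.1-coprimeTo k))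
  ℕ→ℚ≡mkℚ k = ℚ.normalize-coprime (Coprime.sym (Coprime.1-coprimeTo k))
  toℚᵘ-+ : ℚ.toℚᵘ (ℕ→ℚ (m + o)) ℚᵘ.≃ ℚ.toℚᵘ (ℕ→ℚ m) ℚᵘ.+ ℚ.toℚᵘ (ℕ→ℚ o)
  toℚᵘ-+ rewrite ℕ→ℚ≡mkℚ (m + o) | ℕ→ℚ≡mkℚ m | ℕ→ℚ≡mkℚ o = ℚᵘ.*≡* (begin
    ℤ.+ (m + o) ℤ.* ℤ.+ 1                               ≡⟨ ℤ.*-identityʳ _ ⟩
    ℤ.+ (m + o)                                         ≡⟨ ℤ.pos-+ m o ⟩
    ℤ.+ m ℤ.+ ℤ.+ o                                     ≡⟨ cong₂ ℤ._+_ (ℤ.*-identityʳ (ℤ.+ m)) (ℤ.*-identityʳ (ℤ.+ o)) ⟨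
    ℤ.+ m ℤ.* ℤ.+ 1 ℤ.+ ℤ.+ o ℤ.* ℤ.+ 1                 ≡⟨ ℤ.*-identityʳ _ ⟨
    (ℤ.+ m ℤ.* ℤ.+ 1 ℤ.+ ℤ.+ o ℤ.* ℤ.+ 1) ℤ.* ℤ.+ 1     ∎)
    where open ≡-Reasoning

ℕ→ℚ-sum : ∀ {A : Set} (f : A → ℕ) xs → ℕ→ℚ (ℕΣ.sum (map f xs)) ≡ sumℚ (map (ℕ→ℚ ∘ f) xs)
ℕ→ℚ-sum f []       = refl
ℕ→ℚ-sum f (x ∷ xs) = trans (ℕ→ℚ-+ (f x) _) (cong (ℕ→ℚ (f x) ℚ.+_) (ℕ→ℚ-sum f xs))

ℕ→ℚ-nonNeg : ∀ m → 0ℚ ℚ.≤ ℕ→ℚ m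
ℕ→ℚ-nonNeg m = ℚ.nonNegative⁻¹ (ℕ→ℚ m) {{ℚ.normalize-nonNeg m 1}}

*-nonNeg : ∀ {p q} → 0ℚ ℚ.≤ p → 0ℚ ℚ.≤ q → 0ℚ ℚ.≤ p ℚ.* q
*-nonNeg {p} {q} p≥0 q≥0 =
  ℚ.nonNegative⁻¹ (p ℚ.* q) {{ℚ.nonNeg*nonNeg⇒nonNeg p {{ℚ.nonNegative p≥0}} q {{ℚ.nonNegative q≥0}}}}

sum-nonNeg : ∀ {A : Set} {f : A → ℚ} xs → All (λ x → 0ℚ ℚ.≤ f x) xs → 0ℚ ℚ.≤ sumℚ (map f xs)
sum-nonNeg []       []           = ℚ.≤-refl
sum-nonNeg {f = f} (x ∷ xs) (fx≥0 ∷ f≥0) =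
  subst (ℚ._≤ sumℚ (map f (x ∷ xs))) (ℚ.+-identityˡ 0ℚ) (ℚ.+-mono-≤ fx≥0 (sum-nonNeg xs f≥0))

sum-lengthVec : ∀ {n} → 2 ≤ n → (H : HamCycle n) → sumFin (half n) (lengthVec n H) ≡ ℕ→ℚ n
sum-lengthVec {n} 2≤n H = trans (sym (ℕ→ℚ-sum _ (allFin (half n)))) (cong ℕ→ℚ (sum-countLen 2≤n H))

InEL⇒InSimplex : ∀ {n} → 2 ≤ n → ∀ x → InEL n x → InSimplex n x
InEL⇒InSimplex {n} 2≤n x (cs , weights≥0 , Σweights≡1 , x≡Σ) = Σx≡n , x≥0
  where
  d = half n
  w : ℚ × HamCycle n → ℚ
  w = proj₁
  v : ℚ × HamCycle n → Fin d → ℚ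
  v c = lengthVec n (proj₂ c)
  Σx≡n : sumFin d x ≡ ℕ→ℚ n
  Σx≡n = begin
    sumℚ (map x (allFin d))                                            ≡⟨ ℚΣ.sum-cong (allFin d) x≡Σ ⟩
    sumℚ (map (λ i → sumℚ (map (λ c → w c ℚ.* v c i) cs)) (allFin d)) ≡⟨ ℚΣ.sum-comm (λ i c → w c ℚ.* v c i) (allFin d) cs ⟩
    sumℚ (map (λ c → sumℚ (map (λ i → w c ℚ.* v c i) (allFin d))) cs) ≡⟨ ℚΣ.sum-cong cs (λ c → ℚΣ.sum-distribˡ-* (v c) (w c) (allFin d)) ⟩
    sumℚ (map (λ c → w c ℚ.* sumFin d (v c)) cs)                      ≡⟨ ℚΣ.sum-cong cs (λ c → cong (w c ℚ.*_) (sum-lengthVec 2≤n (proj₂ c))) ⟩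
    sumℚ (map (λ c → w c ℚ.* ℕ→ℚ n) cs)                               ≡⟨ ℚΣ.sum-distribʳ-* w (ℕ→ℚ n) cs ⟩
    sumℚ (map w cs) ℚ.* ℕ→ℚ n                                         ≡⟨ cong (ℚ._* ℕ→ℚ n) Σweights≡1 ⟩
    1ℚ ℚ.* ℕ→ℚ n                                                      ≡⟨ ℚ.*-identityˡ (ℕ→ℚ n) ⟩
    ℕ→ℚ n                                                             ∎
    where open ≡-Reasoning
  x≥0 : ∀ i → 0ℚ ℚ.≤ x i
  x≥0 i = subst (0ℚ ℚ.≤_) (sym (x≡Σ i))
    (sum-nonNeg cs (All.map (λ {c} w≥0 → *-nonNeg w≥0 (ℕ→ℚ-nonNeg (countLen n (proj₂ c) (suc (toℕ i))))) weights≥0))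

module StepCycles {n} (prime-n : Prime n) where

  instance
    n≢0 : NonZero n
    n≢0 = prime⇒nonZero prime-n

  module _ {k} .{{_ : NonZero k}} (k+k≤n : k + k ≤ n) where

    vertex : ℕ → Fin n
    vertex t = (t * k) mod n

    toℕ-vertex : ∀ t → toℕ (vertex t) ≡ (t * k) % n
    toℕ-vertex t = toℕ-fromℕ< (m%n<n (t * k) n)

    vertex-periodic : vertex n ≡ vertex 0
    vertex-periodic = fromℕ<-cong _ _ (trans (cong (_% n) (*-comm n k)) (trans (m*n%n≡0 k n) (sym (m*n%n≡0 0 n)))) _ _

    vertex-injective : ∀ {i j} → i < j → j < n → vertex i ≢ vertex j
    vertex-injective {i} {j} i<j j<n vi≡vj = *-%-injective-prime prime-n (>⇒∤ k<n) i<j j<n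
      (trans (sym (toℕ-vertex i)) (trans (cong toℕ vi≡vj) (toℕ-vertex j)))
      where
      k<n : k < n
      k<n = <-≤-trans (m<m+n k (>-nonZero⁻¹ k)) k+k≤n

    edgeLen-vertex-suc : ∀ t → edgeLen n (vertex t) (vertex (suc t)) ≡ k
    edgeLen-vertex-suc t = begin
      cyclicDist n (toℕ (vertex t)) (toℕ (vertex (suc t))) ≡⟨ cong₂ (cyclicDist n) (toℕ-vertex t) (toℕ-vertex (suc t)) ⟩
      cyclicDist n ((t * k) % n) ((k + t * k) % n)         ≡⟨ cong (λ m → cyclicDist n ((t * k) % n) (m % n)) (+-comm k (t * k)) ⟩
      cyclicDist n ((t * k) % n) ((t * k + k) % n)         ≡⟨ cyclicDist-%-+ (t * k) k+k≤n ⟩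
      k                                                    ∎
      where open ≡-Reasoning

    stepCycle : HamCycle n
    stepCycle = hamCycle (applyUpTo vertex n) (applyUpTo⁺₁ vertex n vertex-injective) (length-applyUpTo vertex n)

    edgeLen-stepCycle : All (λ e → uncurry (edgeLen n) e ≡ k) (cycleEdges (verts stepCycle))
    edgeLen-stepCycle = subst (All (λ e → uncurry (edgeLen n) e ≡ k)) (sym (cycleEdges-applyUpTo vertex n vertex-periodic))
      (applyUpTo⁺₂ _ n edgeLen-vertex-suc)

  2[1+i]≤n : (i : Fin (half n)) → suc (toℕ i) + suc (toℕ i) ≤ n
  2[1+i]≤n i = m≤n/2⇒m+m≤n n (toℕ<n i)

  stepCycleAt : Fin (half n) → HamCycle n
  stepCycleAt i = stepCycle (2[1+i]≤n i)

  lengthVec-stepCycleAt : ∀ i → lengthVec n (stepCycleAt i) i ≡ ℕ→ℚ n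
  lengthVec-stepCycleAt i = cong ℕ→ℚ (countLen-uniform (stepCycleAt i) (edgeLen-stepCycle (2[1+i]≤n i)))

  lengthVec-stepCycleAt-≢ : ∀ {i j} → j ≢ i → lengthVec n (stepCycleAt j) i ≡ 0ℚ
  lengthVec-stepCycleAt-≢ {i} {j} j≢i = cong ℕ→ℚ (countLen-uniform-≢ (stepCycleAt j) (edgeLen-stepCycle (2[1+i]≤n j))
    (j≢i ∘ toℕ-injective ∘ suc-injective ∘ sym))

InSimplex⇒InEL : ∀ {n} → Prime n → ∀ x → InSimplex n x → InEL n x
InSimplex⇒InEL {n} prime-n x (Σx≡n , x≥0) = map weighted (allFin d) , weights≥0 , Σweights≡1 , x≡Σ
  where
  open StepCycles prime-n using (n≢0; stepCycleAt; lengthVec-stepCycleAt; lengthVec-stepCycleAt-≢)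
  d = half n
  N = ℕ→ℚ n
  instance
    N>0 : ℚ.Positive N
    N>0 = ℚ.normalize-pos n 1
    N≢0 : ℚ.NonZero N
    N≢0 = ℚ.pos⇒nonZero N
  weighted : Fin d → ℚ × HamCycle n
  weighted i = x i ℚ.* ℚ.1/ N , stepCycleAt i
  weights≥0 : All (λ c → 0ℚ ℚ.≤ proj₁ c) (map weighted (allFin d))
  weights≥0 = All.map⁺ (All.universal (λ i → *-nonNeg (x≥0 i) 1/N≥0) (allFin d))
    where
    1/N≥0 : 0ℚ ℚ.≤ ℚ.1/ N
    1/N≥0 = ℚ.<⇒≤ (ℚ.positive⁻¹ (ℚ.1/ N) {{ℚ.1/pos⇒pos N}})
  Σweights≡1 : sumℚ (map proj₁ (map weighted (allFin d))) ≡ 1ℚ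
  Σweights≡1 = begin
    sumℚ (map proj₁ (map weighted (allFin d)))      ≡⟨ cong sumℚ (map-∘ (allFin d)) ⟨
    sumℚ (map (λ i → x i ℚ.* ℚ.1/ N) (allFin d))   ≡⟨ ℚΣ.sum-distribʳ-* x (ℚ.1/ N) (allFin d) ⟩
    sumFin d x ℚ.* ℚ.1/ N                           ≡⟨ cong (ℚ._* ℚ.1/ N) Σx≡n ⟩
    N ℚ.* ℚ.1/ N                                    ≡⟨ ℚ.*-inverseʳ N ⟩
    1ℚ                                              ∎
    where open ≡-Reasoning
  x≡Σ : ∀ i → x i ≡ sumℚ (map (λ c → proj₁ c ℚ.* lengthVec n (proj₂ c) i) (map weighted (allFin d)))
  x≡Σ i = sym (begin
    sumℚ (map (λ c → proj₁ c ℚ.* lengthVec n (proj₂ c) i) (map weighted (allFin d)))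
      ≡⟨ cong sumℚ (map-∘ (allFin d)) ⟨
    sumℚ (map (λ j → (x j ℚ.* ℚ.1/ N) ℚ.* lengthVec n (stepCycleAt j) i) (allFin d))
      ≡⟨ ℚΣ.sum-allFin-single _ i (λ j j≢i →
           trans (cong (x j ℚ.* ℚ.1/ N ℚ.*_) (lengthVec-stepCycleAt-≢ j≢i)) (ℚ.*-zeroʳ (x j ℚ.* ℚ.1/ N))) ⟩
    (x i ℚ.* ℚ.1/ N) ℚ.* lengthVec n (stepCycleAt i) i ≡⟨ cong (x i ℚ.* ℚ.1/ N ℚ.*_) (lengthVec-stepCycleAt i) ⟩
    (x i ℚ.* ℚ.1/ N) ℚ.* N                             ≡⟨ ℚ.*-assoc (x i) (ℚ.1/ N) N ⟩
    x i ℚ.* (ℚ.1/ N ℚ.* N)                             ≡⟨ cong (x i ℚ.*_) (ℚ.*-inverseˡ N) ⟩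
    x i ℚ.* 1ℚ                                         ≡⟨ ℚ.*-identityʳ (x i) ⟩
    x i                                                ∎)
    where open ≡-Reasoning

mainTheorem2 : (n : ℕ) → 3 ≤ n → Prime n →
    (x : Fin (half n) → ℚ) → (InEL n x → InSimplex n x) × (InSimplex n x → InEL n x)
mainTheorem2 n 3≤n prime-n x = InEL⇒InSimplex (<⇒≤ 3≤n) x , InSimplex⇒InEL prime-n x
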